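{- Let $L$ be a finite ranked lattice with rank function $\rho$ and Möbius function $\mu$, and let $(A_1,\dots,A_n)$ be an ordered partition of the atom set of $L$. Suppose that (1) for all $x\in L$ and all $\mathbf{t}\in\mathcal{T}_x^A$, $|\operatorname{supp}\mathbf{t}|=\rho(x)$; (2) for each $x\in L$ with $x\neq\hat{0}$ there is some $i$ with $|A_i\cap A_x|=1$. Then (a) for all $x\in L$, $\mu(x)=(-1)^{\rho(x)}|\mathcal{T}_x^A|$; and (b) $\chi(L,t)=t^{\rho(L)-n}\prod_{i=1}^n(t-|A_i|)$.
   Context: An atomic transversal is a tuple $\mathbf{t}=(t_1,\dots,t_n)$ with $t_i\in A_i\cup\{\hat{0}\}$ for each $i$. $\operatorname{supp}\mathbf{t}$ is the set of indices $i$ with $t_i\neq\hat{0}$ and $\bigvee\mathbf{t}=t_1\vee\cdots\vee t_n$ in $L$. For $x\in L$, $\mathcal{T}_x^A$ is the set of atomic transversals with $\bigvee\mathbf{t}=x$. $A_x$ denotes the set of atoms of $L$ below $x$. $\rho(L)$ is the maximum rank of an element of $L$, $\mu$ is defined by $\sum_{y\leq x}\mu(y)=\delta_{\hat{0},x}$, and $\chi(L,t)=\sum_{x\in L}\mu(x)t^{\rho(L)-\rho(x)}$. -}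

module Defs where

open import Level using (0ℓ)
open import Data.Nat as ℕ using (ℕ; zero; suc; _∸_)
open import Data.Integer as ℤ using (ℤ; +_; _^_)
open import Data.Fin using (Fin)
open import Data.Fin.Properties using (all?; any?) renaming (_≟_ to _≟F_)
open import Data.Fin.Subset using (Subset; _∈_; Nonempty; _∩_; ∣_∣)
open import Data.Fin.Subset.Properties using (_∈?_)
open import Data.Vec as Vec using (Vec; []; _∷_; lookup)
open import Data.List as List using (List; []; _∷_; map; filter; concatMap; allFin; length; foldr)
open import Data.Product using (∃; _×_; _,_)
open import Data.Sum using (_⊎_)
open import Data.Bool using (if_then_else_)
open import Relation.Nullary using (¬_; Dec; does)
open import Relation.Nullary.Decidable using (_×-dec_; _⊎-dec_; ¬?)
open import Relation.Binary using (Rel; Decidable)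
open import Relation.Binary.PropositionalEquality using (_≡_; _≢_)
open import Relation.Binary.Lattice.Structures using (IsBoundedLattice)
open import Algebra.Core using (Op₂)

sumℤ : List ℤ → ℤ
sumℤ = foldr ℤ._+_ (+ 0)

prodℤ : List ℤ → ℤ
prodℤ = foldr ℤ._*_ (+ 1)

-- A finite lattice, presented (up to isomorphism) on the carrier Fin m,
-- with decidable order.  (Every finite nonempty lattice is bounded, so the
-- bounds ⊤, ⊥ are determined by the order.)
record FiniteLattice : Set₁ where
  field
    m    : ℕ
    _≤_  : Rel (Fin m) 0ℓ
    _≤?_ : Decidable _≤_
    _∨_  : Op₂ (Fin m)
    _∧_  : Op₂ (Fin m)
    ⊤    : Fin m
    ⊥    : Fin m
    isBoundedLattice : IsBoundedLattice _≡_ _≤_ _∨_ _∧_ ⊤ ⊥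

module _ (L : FiniteLattice) where
  open FiniteLattice L

  elements : List (Fin m)
  elements = allFin m

  _<_ : Rel (Fin m) 0ℓ
  x < y = (x ≤ y) × (x ≢ y)

  _<?_ : Decidable _<_
  x <? y = (x ≤? y) ×-dec ¬? (x ≟F y)

  _⋖_ : Rel (Fin m) 0ℓ
  x ⋖ y = (x < y) × (∀ z → ¬ ((x < z) × (z < y)))

  _⋖?_ : Decidable _⋖_
  x ⋖? y = (x <? y) ×-dec all? (λ z → ¬? ((x <? z) ×-dec (z <? y)))

  record IsRankFunction (ρ : Fin m → ℕ) : Set where
    field
      rank-⊥     : ρ ⊥ ≡ 0
      rank-cover : ∀ x y → x ⋖ y → ρ y ≡ suc (ρ x)

  rankL : (Fin m → ℕ) → ℕ
  rankL ρ = foldr ℕ._⊔_ 0 (map ρ elements)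

  IsAtom : Fin m → Set
  IsAtom a = ⊥ ⋖ a

  atomsBelow : Fin m → Subset m
  atomsBelow x = Vec.tabulate (λ a → does ((⊥ ⋖? a) ×-dec (a ≤? x)))

  δ⊥ : Fin m → ℤ
  δ⊥ x = if does (⊥ ≟F x) then + 1 else + 0

  IsMobius : (Fin m → ℤ) → Set
  IsMobius μ = ∀ x → sumℤ (map μ (filter (λ y → y ≤? x) elements)) ≡ δ⊥ x

  χ : (ρ : Fin m → ℕ) (μ : Fin m → ℤ) → ℤ → ℤ
  χ ρ μ t = sumℤ (map (λ x → μ x ℤ.* (t ^ (rankL ρ ∸ ρ x))) elements)

  record AtomPartition (n : ℕ) : Set where
    field
      block    : Fin n → Subset m
      covers   : ∀ a → IsAtom a → ∃ λ i → a ∈ block i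
      onlyAtoms : ∀ i a → a ∈ block i → IsAtom a
      disjoint : ∀ i j a → a ∈ block i → a ∈ block j → i ≡ j
      nonempty : ∀ i → Nonempty (block i)

  module _ {n : ℕ} (A : AtomPartition n) where
    open AtomPartition A

    IsTransversal : Vec (Fin m) n → Set
    IsTransversal t = ∀ i → (lookup t i ≡ ⊥) ⊎ (lookup t i ∈ block i)

    isTransversal? : (t : Vec (Fin m) n) → Dec (IsTransversal t)
    isTransversal? t = all? (λ i → (lookup t i ≟F ⊥) ⊎-dec (lookup t i ∈? block i))

    join : ∀ {k} → Vec (Fin m) k → Fin m
    join = Vec.foldr _ _∨_ ⊥

    suppSize : Vec (Fin m) n → ℕ
    suppSize t = length (filter (λ i → ¬? (lookup t i ≟F ⊥)) (allFin n))

    allTuples : (k : ℕ) → List (Vec (Fin m) k)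
    allTuples zero    = [] ∷ []
    allTuples (suc k) = concatMap (λ a → map (a ∷_) (allTuples k)) elements

    numTransversals : Fin m → ℕ
    numTransversals x =
      length (filter (λ t → isTransversal? t ×-dec (join t ≟F x)) (allTuples n))

module Submission where

-- Put f x = (-1)^ρ(x) |T_x|.  By (1), Σ_{y ≤ x} f y is a signed count of the transversals t with
-- ⋁ t ≤ x, i.e. of the transversals of the restricted blocks A_i ∩ A_x, weighted by (-1)^|supp t|.
-- Expanding a product over the blocks, this equals ∏_i (1 - |A_i ∩ A_x|), which by (2) is δ_{0̂,x}.
-- So f satisfies the recursion defining μ, and μ = f.  Substituting this into χ turns it into
-- Σ_t t^(ρ(L) - |supp t|) (-1)^|supp t| over all transversals, which factors the same way as
-- t^(ρ(L) - n) ∏_i (t - |A_i|).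

open import Defs
open import Level using (0ℓ)
open import Data.Nat as ℕ using (ℕ; zero; suc; _∸_)
import Data.Nat.Properties as ℕP
open import Data.Nat.Induction using (<-wellFounded)
open import Data.Integer as ℤ using (ℤ; +_; -_; _*_; _-_; _^_; _+_; 1ℤ; -1ℤ)
import Data.Integer.Properties as ℤP
open import Data.Integer.Tactic.RingSolver using (solve-∀)
open import Algebra.Properties.AbelianGroup ℤP.+-0-abelianGroup using (∙-cancelʳ)
open import Data.Fin using (Fin; zero; suc)
open import Data.Fin.Properties using (all?; ¬∀⟶∃¬) renaming (_≟_ to _≟F_)
open import Data.Fin.Subset using (Subset; _∈_; _∉_; _⊂_; _∩_; ∣_∣; inside; outside)
open import Data.Fin.Subset.Properties using (_∈?_; x∈p∩q⁺; x∈p∩q⁻; Empty-unique; ∣⊥∣≡0; p⊂q⇒∣p∣<∣q∣)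
open import Data.Vec as Vec using (Vec; []; _∷_; lookup)
import Data.Vec.Properties as VP
open import Data.List as List using (List; []; _∷_; map; filter; concatMap; allFin; length; _++_)
import Data.List.Properties as LP
open import Data.List.Membership.Propositional using () renaming (_∈_ to _∈ˡ_)
open import Data.List.Membership.Propositional.Properties using (∈-allFin; ∈-map⁺)
open import Data.List.Relation.Unary.Any using (here; there)
open import Data.Bool using (if_then_else_)
open import Data.Product using (∃; _×_; _,_; proj₁; proj₂)
open import Data.Sum using (_⊎_; inj₁; inj₂; map₂)
open import Function using (_∘_; _on_)
open import Induction.WellFounded using (Acc; acc)
import Relation.Binary.Construct.On as On
open import Relation.Nullary using (Dec; yes; no; does; ¬_; contradiction)
open import Relation.Nullary.Decidable using (_×-dec_; _⊎-dec_; ¬?; dec-true)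
open import Relation.Unary using (Pred; Decidable)
open import Relation.Binary.PropositionalEquality
open import Relation.Binary.Lattice.Structures using (IsBoundedLattice)

𝟙 : {P : Set} → Dec P → ℤ
𝟙 P? = if does P? then + 1 else + 0

𝟙-×-dec : {P Q : Set} (P? : Dec P) (Q? : Dec Q) → 𝟙 (P? ×-dec Q?) ≡ 𝟙 P? * 𝟙 Q?
𝟙-×-dec (yes _) (yes _) = refl
𝟙-×-dec (yes _) (no _)  = refl
𝟙-×-dec (no _)  (yes _) = refl
𝟙-×-dec (no _)  (no _)  = refl

𝟙-cong : {P Q : Set} → (P → Q) → (Q → P) → (P? : Dec P) (Q? : Dec Q) → 𝟙 P? ≡ 𝟙 Q?
𝟙-cong P→Q Q→P (yes p) (yes q) = refl
𝟙-cong P→Q Q→P (yes p) (no ¬q) = contradiction (P→Q p) ¬q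
𝟙-cong P→Q Q→P (no ¬p) (yes q) = contradiction (Q→P q) ¬p
𝟙-cong P→Q Q→P (no ¬p) (no ¬q) = refl

𝟙-*-cong : {P : Set} (P? : Dec P) {a b : ℤ} → (P → a ≡ b) → 𝟙 P? * a ≡ 𝟙 P? * b
𝟙-*-cong (yes p) a≡b = cong (+ 1 *_) (a≡b p)
𝟙-*-cong (no _) {a} {b} _ = trans (ℤP.*-zeroˡ a) (sym (ℤP.*-zeroˡ b))

sumℤ-++ : (xs ys : List ℤ) → sumℤ (xs ++ ys) ≡ sumℤ xs + sumℤ ys
sumℤ-++ []       ys = sym (ℤP.+-identityˡ _)
sumℤ-++ (x ∷ xs) ys = trans (cong (_+_ x) (sumℤ-++ xs ys)) (sym (ℤP.+-assoc x _ _))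

module _ {A : Set} where

  sumℤ-map-cong : {f g : A → ℤ} → (∀ x → f x ≡ g x) → (xs : List A) →
                  sumℤ (map f xs) ≡ sumℤ (map g xs)
  sumℤ-map-cong f≗g xs = cong sumℤ (LP.map-cong f≗g xs)

  sumℤ-map-zero : (xs : List A) → sumℤ (map (λ _ → + 0) xs) ≡ + 0
  sumℤ-map-zero []       = refl
  sumℤ-map-zero (x ∷ xs) = trans (ℤP.+-identityˡ _) (sumℤ-map-zero xs)

  sumℤ-map-+ : (f g : A → ℤ) (xs : List A) →
               sumℤ (map (λ x → f x + g x) xs) ≡ sumℤ (map f xs) + sumℤ (map g xs)
  sumℤ-map-+ f g []       = refl
  sumℤ-map-+ f g (x ∷ xs) = begin
    f x + g x + sumℤ (map (λ x → f x + g x) xs)        ≡⟨ cong (_+_ (f x + g x)) (sumℤ-map-+ f g xs) ⟩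
    f x + g x + (sumℤ (map f xs) + sumℤ (map g xs))    ≡⟨ interchange (f x) (g x) _ _ ⟩
    f x + sumℤ (map f xs) + (g x + sumℤ (map g xs))    ∎
    where
    open ≡-Reasoning
    interchange : ∀ a b c d → a + b + (c + d) ≡ a + c + (b + d)
    interchange = solve-∀

  sumℤ-map-*ˡ : (c : ℤ) (f : A → ℤ) (xs : List A) →
                sumℤ (map (λ x → c * f x) xs) ≡ c * sumℤ (map f xs)
  sumℤ-map-*ˡ c f []       = sym (ℤP.*-zeroʳ c)
  sumℤ-map-*ˡ c f (x ∷ xs) =
    trans (cong (_+_ (c * f x)) (sumℤ-map-*ˡ c f xs)) (sym (ℤP.*-distribˡ-+ c (f x) _))

  sumℤ-map-*ʳ : (f : A → ℤ) (c : ℤ) (xs : List A) →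
                sumℤ (map (λ x → f x * c) xs) ≡ sumℤ (map f xs) * c
  sumℤ-map-*ʳ f c xs = trans (sumℤ-map-cong (λ x → ℤP.*-comm (f x) c) xs)
                             (trans (sumℤ-map-*ˡ c f xs) (ℤP.*-comm c _))

  sumℤ-filter : {P : Pred A 0ℓ} (P? : Decidable P) (f : A → ℤ) (xs : List A) →
                sumℤ (map f (filter P? xs)) ≡ sumℤ (map (λ x → 𝟙 (P? x) * f x) xs)
  sumℤ-filter P? f []       = refl
  sumℤ-filter P? f (x ∷ xs) with P? x
  ... | yes _ = cong₂ _+_ (sym (ℤP.*-identityˡ (f x))) (sumℤ-filter P? f xs)
  ... | no _  = trans (sumℤ-filter P? f xs)
                      (sym (trans (cong (_+ sumℤ (map (λ x → 𝟙 (P? x) * f x) xs)) (ℤP.*-zeroˡ (f x)))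
                                  (ℤP.+-identityˡ _)))

  length-filter≡sumℤ-𝟙 : {P : Pred A 0ℓ} (P? : Decidable P) (xs : List A) →
                         + length (filter P? xs) ≡ sumℤ (map (λ x → 𝟙 (P? x)) xs)
  length-filter≡sumℤ-𝟙 P? []       = refl
  length-filter≡sumℤ-𝟙 P? (x ∷ xs) with P? x
  ... | yes _ = cong (_+_ (+ 1)) (length-filter≡sumℤ-𝟙 P? xs)
  ... | no _  = trans (length-filter≡sumℤ-𝟙 P? xs) (sym (ℤP.+-identityˡ _))

  map-allFin-suc : ∀ {k} (f : Fin (suc k) → A) → map f (allFin (suc k)) ≡ f zero ∷ map (f ∘ suc) (allFin k)
  map-allFin-suc f = cong (f zero ∷_) (trans (LP.map-tabulate suc f) (sym (LP.map-tabulate (λ i → i) (f ∘ suc))))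

  module _ {P : Pred A 0ℓ} (P? : Decidable P) where

    length-filter∘tabulate : ∀ {k l} (f : Fin l → A) (g : Fin k → Fin l) →
                             length (filter (P? ∘ f) (List.tabulate g)) ≡ Vec.count P? (Vec.tabulate (f ∘ g))
    length-filter∘tabulate {zero}  f g = refl
    length-filter∘tabulate {suc k} f g with P? (f (g zero))
    ... | yes _ = cong suc (length-filter∘tabulate f (g ∘ suc))
    ... | no _  = length-filter∘tabulate f (g ∘ suc)

    length-filter-lookup : ∀ {k} (t : Vec A k) → length (filter (P? ∘ lookup t) (allFin k)) ≡ Vec.count P? t
    length-filter-lookup t = trans (length-filter∘tabulate (lookup t) (λ i → i)) (cong (Vec.count P?) (VP.tabulate∘lookup t))

    count+count¬ : ∀ {k} (t : Vec A k) → Vec.count P? t ℕ.+ Vec.count (¬? ∘ P?) t ≡ k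
    count+count¬ []      = refl
    count+count¬ (a ∷ t) with P? a
    ... | yes _ = cong suc (count+count¬ t)
    ... | no _  = trans (ℕP.+-suc _ _) (cong suc (count+count¬ t))

    count-all : ∀ {k} (t : Vec A k) → (∀ i → P (lookup t i)) → Vec.count P? t ≡ k
    count-all []      _   = refl
    count-all (a ∷ t) all with P? a
    ... | yes _ = cong suc (count-all t (all ∘ suc))
    ... | no ¬p = contradiction (all zero) ¬p

module _ {A B : Set} where

  sumℤ-concatMap : (f : B → ℤ) (g : A → List B) (xs : List A) →
                   sumℤ (map f (concatMap g xs)) ≡ sumℤ (map (λ x → sumℤ (map f (g x))) xs)
  sumℤ-concatMap f g []       = refl
  sumℤ-concatMap f g (x ∷ xs) =
    trans (cong sumℤ (LP.map-++ f (g x) (concatMap g xs)))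
          (trans (sumℤ-++ (map f (g x)) _) (cong (_+_ (sumℤ (map f (g x)))) (sumℤ-concatMap f g xs)))

  sumℤ-swap : (F : A → B → ℤ) (xs : List A) (ys : List B) →
              sumℤ (map (λ x → sumℤ (map (F x) ys)) xs) ≡ sumℤ (map (λ y → sumℤ (map (λ x → F x y) xs)) ys)
  sumℤ-swap F []       ys = sym (sumℤ-map-zero ys)
  sumℤ-swap F (x ∷ xs) ys = trans (cong (_+_ (sumℤ (map (F x) ys))) (sumℤ-swap F xs ys))
                                  (sym (sumℤ-map-+ (F x) _ ys))

sumℤ-δ : ∀ {k} (c : Fin k) (h : Fin k → ℤ) → sumℤ (map (λ y → 𝟙 (c ≟F y) * h y) (allFin k)) ≡ h c
sumℤ-δ {suc k} zero h = begin
  sumℤ (map (λ y → 𝟙 (zero ≟F y) * h y) (allFin (suc k)))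
    ≡⟨ cong sumℤ (map-allFin-suc (λ y → 𝟙 (zero ≟F y) * h y)) ⟩
  + 1 * h zero + sumℤ (map (λ y → + 0 * h (suc y)) (allFin k))
    ≡⟨ cong₂ _+_ (ℤP.*-identityˡ (h zero)) (sumℤ-map-cong (ℤP.*-zeroˡ ∘ h ∘ suc) (allFin k)) ⟩
  h zero + sumℤ (map (λ _ → + 0) (allFin k))                 ≡⟨ cong (_+_ (h zero)) (sumℤ-map-zero (allFin k)) ⟩
  h zero + + 0                                               ≡⟨ ℤP.+-identityʳ (h zero) ⟩
  h zero                                                     ∎
  where open ≡-Reasoning
sumℤ-δ {suc k} (suc c) h = begin
  sumℤ (map (λ y → 𝟙 (suc c ≟F y) * h y) (allFin (suc k)))
    ≡⟨ cong sumℤ (map-allFin-suc (λ y → 𝟙 (suc c ≟F y) * h y)) ⟩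
  + 0 * h zero + sumℤ (map (λ y → 𝟙 (c ≟F y) * h (suc y)) (allFin k))
    ≡⟨ cong₂ _+_ (ℤP.*-zeroˡ (h zero)) (sumℤ-δ c (h ∘ suc)) ⟩
  + 0 + h (suc c)                                            ≡⟨ ℤP.+-identityˡ _ ⟩
  h (suc c)                                                  ∎
  where open ≡-Reasoning

sumℤ-𝟙-∈ : ∀ {k} (S : Subset k) → sumℤ (map (λ a → 𝟙 (a ∈? S)) (allFin k)) ≡ + ∣ S ∣
sumℤ-𝟙-∈ []            = refl
sumℤ-𝟙-∈ (inside ∷ S)  =
  trans (cong sumℤ (map-allFin-suc (λ a → 𝟙 (a ∈? (inside ∷ S))))) (cong (_+_ (+ 1)) (sumℤ-𝟙-∈ S))
sumℤ-𝟙-∈ (outside ∷ S) =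
  trans (cong sumℤ (map-allFin-suc (λ a → 𝟙 (a ∈? (outside ∷ S))))) (trans (ℤP.+-identityˡ _) (sumℤ-𝟙-∈ S))

prodℤ-map-zero : ∀ {k} (h : Fin k → ℤ) (i : Fin k) → h i ≡ + 0 → prodℤ (map h (allFin k)) ≡ + 0
prodℤ-map-zero h zero    hi≡0 =
  trans (cong prodℤ (map-allFin-suc h)) (cong (_* prodℤ (map (h ∘ suc) (allFin _))) hi≡0)
prodℤ-map-zero h (suc i) hi≡0 =
  trans (cong prodℤ (map-allFin-suc h))
        (trans (cong (h zero *_) (prodℤ-map-zero (h ∘ suc) i hi≡0)) (ℤP.*-zeroʳ (h zero)))

prodℤ-map-one : ∀ {k} (h : Fin k → ℤ) → (∀ i → h i ≡ + 1) → prodℤ (map h (allFin k)) ≡ + 1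
prodℤ-map-one {zero}  h _     = refl
prodℤ-map-one {suc k} h all≡1 =
  trans (cong prodℤ (map-allFin-suc h)) (cong₂ _*_ (all≡1 zero) (prodℤ-map-one (h ∘ suc) (all≡1 ∘ suc)))

sumℤ-fibres : ∀ {k} {X : Set} {P : Pred X 0ℓ} (P? : Decidable P) (j : X → Fin k) (G : Fin k → ℤ)
              (xs : List X) →
              sumℤ (map (λ y → G y * + length (filter (λ x → P? x ×-dec (j x ≟F y)) xs)) (allFin k))
              ≡ sumℤ (map (λ x → 𝟙 (P? x) * G (j x)) xs)
sumℤ-fibres {k} P? j G xs = begin
  sumℤ (map (λ y → G y * + length (filter (λ x → P? x ×-dec (j x ≟F y)) xs)) (allFin k))
    ≡⟨ sumℤ-map-cong (λ y → trans (cong (G y *_) (length-filter≡sumℤ-𝟙 _ xs))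
                                  (sym (sumℤ-map-*ˡ (G y) _ xs))) (allFin k) ⟩
  sumℤ (map (λ y → sumℤ (map (λ x → G y * 𝟙 (P? x ×-dec (j x ≟F y))) xs)) (allFin k))
    ≡⟨ sumℤ-swap (λ y x → G y * 𝟙 (P? x ×-dec (j x ≟F y))) (allFin k) xs ⟩
  sumℤ (map (λ x → sumℤ (map (λ y → G y * 𝟙 (P? x ×-dec (j x ≟F y))) (allFin k))) xs)
    ≡⟨ sumℤ-map-cong fibre xs ⟩
  sumℤ (map (λ x → 𝟙 (P? x) * G (j x)) xs) ∎
  where
  open ≡-Reasoning
  rearrange : ∀ a b c → a * (b * c) ≡ b * (c * a)
  rearrange = solve-∀
  fibre : ∀ x → sumℤ (map (λ y → G y * 𝟙 (P? x ×-dec (j x ≟F y))) (allFin k)) ≡ 𝟙 (P? x) * G (j x)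
  fibre x = begin
    sumℤ (map (λ y → G y * 𝟙 (P? x ×-dec (j x ≟F y))) (allFin k))
      ≡⟨ sumℤ-map-cong (λ y → trans (cong (G y *_) (𝟙-×-dec (P? x) (j x ≟F y)))
                                    (rearrange (G y) (𝟙 (P? x)) (𝟙 (j x ≟F y)))) (allFin k) ⟩
    sumℤ (map (λ y → 𝟙 (P? x) * (𝟙 (j x ≟F y) * G y)) (allFin k))
      ≡⟨ sumℤ-map-*ˡ (𝟙 (P? x)) (λ y → 𝟙 (j x ≟F y) * G y) (allFin k) ⟩
    𝟙 (P? x) * sumℤ (map (λ y → 𝟙 (j x ≟F y) * G y) (allFin k))
      ≡⟨ cong (𝟙 (P? x) *_) (sumℤ-δ (j x) G) ⟩
    𝟙 (P? x) * G (j x) ∎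

module _ {k : ℕ} {P : Pred (Fin k) 0ℓ} (P? : Decidable P) where

  ∈-tabulate⁻ : ∀ {x} → x ∈ Vec.tabulate (does ∘ P?) → P x
  ∈-tabulate⁻ {x} x∈ with P? x | trans (sym (VP.lookup∘tabulate (does ∘ P?) x)) (VP.[]=⇒lookup x∈)
  ... | yes px | _ = px
  ... | no _   | ()

  ∈-tabulate⁺ : ∀ {x} → P x → x ∈ Vec.tabulate (does ∘ P?)
  ∈-tabulate⁺ {x} px = VP.lookup⇒[]= x _ (trans (VP.lookup∘tabulate (does ∘ P?) x) (dec-true (P? x) px))

≤-foldr-⊔ : ∀ {x xs} → x ∈ˡ xs → x ℕ.≤ List.foldr ℕ._⊔_ 0 xs
≤-foldr-⊔ {x} (here refl)          = ℕP.m≤m⊔n x _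
≤-foldr-⊔ {xs = y ∷ _} (there x∈) = ℕP.≤-trans (≤-foldr-⊔ x∈) (ℕP.m≤n⊔m y _)

m∸n≡m∸[o+n]+o : ∀ {m n} o → o ℕ.+ n ℕ.≤ m → m ∸ n ≡ m ∸ (o ℕ.+ n) ℕ.+ o
m∸n≡m∸[o+n]+o {m} {n} o o+n≤m = begin
  m ∸ n                             ≡⟨ cong (_∸ n) (sym (ℕP.m∸n+n≡m o+n≤m)) ⟩
  (m ∸ (o ℕ.+ n) ℕ.+ (o ℕ.+ n)) ∸ n  ≡⟨ cong (_∸ n) (sym (ℕP.+-assoc (m ∸ (o ℕ.+ n)) o n)) ⟩
  (m ∸ (o ℕ.+ n) ℕ.+ o ℕ.+ n) ∸ n    ≡⟨ ℕP.m+n∸n≡m _ n ⟩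
  m ∸ (o ℕ.+ n) ℕ.+ o               ∎
  where open ≡-Reasoning

module LatticeFacts (L : FiniteLattice) where
  open FiniteLattice L
  open IsBoundedLattice isBoundedLattice
    using (antisym; minimum) renaming (refl to ≤-refl; trans to ≤-trans)

  atom≢⊥ : ∀ {a} → IsAtom L a → a ≢ ⊥
  atom≢⊥ ((_ , ⊥≢a) , _) a≡⊥ = ⊥≢a (sym a≡⊥)

  ∈-atomsBelow⁻ : ∀ {a x} → a ∈ atomsBelow L x → IsAtom L a × a ≤ x
  ∈-atomsBelow⁻ {x = x} = ∈-tabulate⁻ (λ a → _⋖?_ L ⊥ a ×-dec (a ≤? x))

  ∈-atomsBelow⁺ : ∀ {a x} → IsAtom L a → a ≤ x → a ∈ atomsBelow L x
  ∈-atomsBelow⁺ {x = x} at a≤x = ∈-tabulate⁺ (λ a → _⋖?_ L ⊥ a ×-dec (a ≤? x)) (at , a≤x)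

  atomsBelow-⊥-empty : (S : Subset m) → ∣ S ∩ atomsBelow L ⊥ ∣ ≡ 0
  atomsBelow-⊥-empty S = trans (cong ∣_∣ (Empty-unique no-atom)) (∣⊥∣≡0 m)
    where
    no-atom : ¬ ∃ (λ a → a ∈ S ∩ atomsBelow L ⊥)
    no-atom (a , a∈) = let at , a≤⊥ = ∈-atomsBelow⁻ (proj₂ (x∈p∩q⁻ S _ a∈)) in
                       atom≢⊥ at (antisym a≤⊥ (minimum a))

  ↓_ : Fin m → Subset m
  ↓ x = Vec.tabulate (λ y → does (y ≤? x))

  ↓-mono-< : ∀ {x y} → _<_ L y x → ↓ y ⊂ ↓ x
  ↓-mono-< {x} {y} (y≤x , y≢x) =
    (λ z∈↓y → ∈-tabulate⁺ (_≤? x) (≤-trans (∈-tabulate⁻ (_≤? y) z∈↓y) y≤x)) ,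
    x , ∈-tabulate⁺ (_≤? x) ≤-refl , λ x∈↓y → y≢x (antisym y≤x (∈-tabulate⁻ (_≤? y) x∈↓y))

  𝟙-≤-split : ∀ x y → 𝟙 (y ≤? x) ≡ 𝟙 (x ≟F y) + 𝟙 (_<?_ L y x)
  𝟙-≤-split x y with y ≤? x | x ≟F y | y ≟F x
  ... | yes _  | yes _    | yes _   = refl
  ... | yes _  | yes x≡y  | no y≢x  = contradiction (sym x≡y) y≢x
  ... | yes _  | no x≢y   | yes y≡x = contradiction (sym y≡x) x≢y
  ... | yes _  | no _     | no _    = refl
  ... | no y≰x | yes refl | _       = contradiction ≤-refl y≰x
  ... | no _   | no _     | _       = refl

  sumℤ-≤-split : (g : Fin m → ℤ) (x : Fin m) →
                 sumℤ (map g (filter (_≤? x) (elements L)))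
                 ≡ g x + sumℤ (map (λ y → 𝟙 (_<?_ L y x) * g y) (elements L))
  sumℤ-≤-split g x = begin
    sumℤ (map g (filter (_≤? x) (elements L)))
      ≡⟨ sumℤ-filter (_≤? x) g (elements L) ⟩
    sumℤ (map (λ y → 𝟙 (y ≤? x) * g y) (elements L))
      ≡⟨ sumℤ-map-cong (λ y → trans (cong (_* g y) (𝟙-≤-split x y))
                                      (ℤP.*-distribʳ-+ (g y) (𝟙 (x ≟F y)) (𝟙 (_<?_ L y x)))) (elements L) ⟩
    sumℤ (map (λ y → 𝟙 (x ≟F y) * g y + 𝟙 (_<?_ L y x) * g y) (elements L))
      ≡⟨ sumℤ-map-+ (λ y → 𝟙 (x ≟F y) * g y) (λ y → 𝟙 (_<?_ L y x) * g y) (elements L) ⟩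
    sumℤ (map (λ y → 𝟙 (x ≟F y) * g y) (elements L)) + sumℤ (map (λ y → 𝟙 (_<?_ L y x) * g y) (elements L))
      ≡⟨ cong (_+ sumℤ (map (λ y → 𝟙 (_<?_ L y x) * g y) (elements L))) (sumℤ-δ x g) ⟩
    g x + sumℤ (map (λ y → 𝟙 (_<?_ L y x) * g y) (elements L))       ∎
    where open ≡-Reasoning

  -- The defining recursion fixes f x from the values strictly below x; induct on ∣ ↓ x ∣.
  mobius-unique : ∀ {f g} → IsMobius L f → IsMobius L g → ∀ x → f x ≡ g x
  mobius-unique {f} {g} f-mob g-mob x = go x (On.wellFounded (∣_∣ ∘ ↓_) <-wellFounded x)
    where
    go : ∀ x → Acc (ℕ._<_ on (∣_∣ ∘ ↓_)) x → f x ≡ g x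
    go x (acc rs) = ∙-cancelʳ (sumℤ (map (λ y → 𝟙 (_<?_ L y x) * f y) (elements L))) (f x) (g x) (begin
      f x + sumℤ (map (λ y → 𝟙 (_<?_ L y x) * f y) (elements L))  ≡⟨ sym (sumℤ-≤-split f x) ⟩
      sumℤ (map f (filter (_≤? x) (elements L)))                  ≡⟨ trans (f-mob x) (sym (g-mob x)) ⟩
      sumℤ (map g (filter (_≤? x) (elements L)))                  ≡⟨ sumℤ-≤-split g x ⟩
      g x + sumℤ (map (λ y → 𝟙 (_<?_ L y x) * g y) (elements L))  ≡⟨ cong (_+_ (g x)) (sumℤ-map-cong below (elements L)) ⟩
      g x + sumℤ (map (λ y → 𝟙 (_<?_ L y x) * f y) (elements L))  ∎)
      where
      open ≡-Reasoning
      below : ∀ y → 𝟙 (_<?_ L y x) * g y ≡ 𝟙 (_<?_ L y x) * f y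
      below y = 𝟙-*-cong (_<?_ L y x) (λ y<x → sym (go y (rs (p⊂q⇒∣p∣<∣q∣ (↓-mono-< y<x)))))

module Transversals (L : FiniteLattice) {n : ℕ} (A : AtomPartition L n) where
  open FiniteLattice L
  open IsBoundedLattice isBoundedLattice using (minimum; x≤x∨y; y≤x∨y; ∨-least) renaming (trans to ≤-trans)

  tupleWeight : ∀ {k} → (Fin k → Fin m → ℤ) → Vec (Fin m) k → ℤ
  tupleWeight w []      = + 1
  tupleWeight w (a ∷ t) = w zero a * tupleWeight (w ∘ suc) t

  tupleWeight-zero : ∀ {k} (w : Fin k → Fin m → ℤ) (t : Vec (Fin m) k) (i : Fin k) →
                     w i (lookup t i) ≡ + 0 → tupleWeight w t ≡ + 0
  tupleWeight-zero w (a ∷ t) zero    wi≡0 = cong (_* tupleWeight (w ∘ suc) t) wi≡0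
  tupleWeight-zero w (a ∷ t) (suc i) wi≡0 =
    trans (cong (w zero a *_) (tupleWeight-zero (w ∘ suc) t i wi≡0)) (ℤP.*-zeroʳ (w zero a))

  sumℤ-tupleWeight : ∀ k (w : Fin k → Fin m → ℤ) →
                     sumℤ (map (tupleWeight w) (allTuples L A k))
                     ≡ prodℤ (map (λ i → sumℤ (map (w i) (elements L))) (allFin k))
  sumℤ-tupleWeight zero    w = refl
  sumℤ-tupleWeight (suc k) w = begin
    sumℤ (map (tupleWeight w) (concatMap (λ a → map (a ∷_) ts) (elements L)))
      ≡⟨ sumℤ-concatMap (tupleWeight w) (λ a → map (a ∷_) ts) (elements L) ⟩
    sumℤ (map (λ a → sumℤ (map (tupleWeight w) (map (a ∷_) ts))) (elements L))
      ≡⟨ sumℤ-map-cong head (elements L) ⟩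
    sumℤ (map (λ a → w zero a * sumℤ (map (tupleWeight (w ∘ suc)) ts)) (elements L))
      ≡⟨ sumℤ-map-*ʳ (w zero) _ (elements L) ⟩
    sumℤ (map (w zero) (elements L)) * sumℤ (map (tupleWeight (w ∘ suc)) ts)
      ≡⟨ cong (sumℤ (map (w zero) (elements L)) *_) (sumℤ-tupleWeight k (w ∘ suc)) ⟩
    sumℤ (map (w zero) (elements L)) * prodℤ (map (λ i → sumℤ (map (w (suc i)) (elements L))) (allFin k))
      ≡⟨ cong prodℤ (sym (map-allFin-suc (λ i → sumℤ (map (w i) (elements L))))) ⟩
    prodℤ (map (λ i → sumℤ (map (w i) (elements L))) (allFin (suc k))) ∎
    where
    open ≡-Reasoning
    ts = allTuples L A k
    head : ∀ a → sumℤ (map (tupleWeight w) (map (a ∷_) ts))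
                 ≡ w zero a * sumℤ (map (tupleWeight (w ∘ suc)) ts)
    head a = trans (cong sumℤ (sym (LP.map-∘ ts))) (sumℤ-map-*ˡ (w zero a) (tupleWeight (w ∘ suc)) ts)

  -- For B = block these are IsTransversal L A and isTransversal? L A, definitionally.
  IsTransversalOf : ∀ {k} → (Fin k → Subset m) → Vec (Fin m) k → Set
  IsTransversalOf B t = ∀ i → (lookup t i ≡ ⊥) ⊎ (lookup t i ∈ B i)

  transversal? : ∀ {k} (B : Fin k → Subset m) (t : Vec (Fin m) k) → Dec (IsTransversalOf B t)
  transversal? B t = all? (λ i → (lookup t i ≟F ⊥) ⊎-dec (lookup t i ∈? B i))

  zeros support : ∀ {k} → Vec (Fin m) k → ℕ
  zeros   = Vec.count (_≟F ⊥)
  support = Vec.count (λ a → ¬? (a ≟F ⊥))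

  support≡suppSize : (t : Vec (Fin m) n) → suppSize L A t ≡ support t
  support≡suppSize = length-filter-lookup (λ a → ¬? (a ≟F ⊥))

  zeros+support : ∀ {k} (t : Vec (Fin m) k) → zeros t ℕ.+ support t ≡ k
  zeros+support = count+count¬ (_≟F ⊥)

  blockWeight : ℤ → ℤ → ∀ {k} → (Fin k → Subset m) → Fin k → Fin m → ℤ
  blockWeight u v B i a = 𝟙 (a ≟F ⊥) * u + 𝟙 (a ∈? B i) * v

  module _ (u v : ℤ) where

    tupleWeight-transversal : ∀ {k} (B : Fin k → Subset m) → (∀ i → ⊥ ∉ B i) →
                              ∀ t → IsTransversalOf B t →
                              tupleWeight (blockWeight u v B) t ≡ u ^ zeros t * v ^ support t
    tupleWeight-transversal B ⊥∉B []      _  = refl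
    tupleWeight-transversal B ⊥∉B (a ∷ t) tr with a ≟F ⊥ | a ∈? B zero | tr zero
    ... | yes refl | yes ⊥∈B₀ | _         = contradiction ⊥∈B₀ (⊥∉B zero)
    ... | yes refl | no _     | _         =
      trans (cong ((+ 1 * u + + 0 * v) *_) (tupleWeight-transversal (B ∘ suc) (⊥∉B ∘ suc) t (tr ∘ suc)))
            (⊥-step u v (u ^ zeros t) (v ^ support t))
      where ⊥-step : ∀ u v x y → (+ 1 * u + + 0 * v) * (x * y) ≡ u * x * y
            ⊥-step = solve-∀
    ... | no _     | yes _    | _         =
      trans (cong ((+ 0 * u + + 1 * v) *_) (tupleWeight-transversal (B ∘ suc) (⊥∉B ∘ suc) t (tr ∘ suc)))
            (atom-step u v (u ^ zeros t) (v ^ support t))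
      where atom-step : ∀ u v x y → (+ 0 * u + + 1 * v) * (x * y) ≡ x * (v * y)
            atom-step = solve-∀
    ... | no a≢⊥   | no _     | inj₁ a≡⊥  = contradiction a≡⊥ a≢⊥
    ... | no _     | no a∉B₀  | inj₂ a∈B₀ = contradiction a∈B₀ a∉B₀

    blockWeight-outside : ∀ {k} (B : Fin k → Subset m) i a → ¬ ((a ≡ ⊥) ⊎ (a ∈ B i)) →
                          blockWeight u v B i a ≡ + 0
    blockWeight-outside B i a a∉ with a ≟F ⊥ | a ∈? B i
    ... | yes a≡⊥ | _       = contradiction (inj₁ a≡⊥) a∉
    ... | no _    | yes a∈B = contradiction (inj₂ a∈B) a∉
    ... | no _    | no _    = refl

    tupleWeight-nonTransversal : ∀ {k} (B : Fin k → Subset m) t → ¬ IsTransversalOf B t →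
                                 tupleWeight (blockWeight u v B) t ≡ + 0
    tupleWeight-nonTransversal {k} B t ¬tr =
      let i , ¬trᵢ = ¬∀⟶∃¬ k _ (λ i → (lookup t i ≟F ⊥) ⊎-dec (lookup t i ∈? B i)) ¬tr
      in tupleWeight-zero (blockWeight u v B) t i (blockWeight-outside B i (lookup t i) ¬trᵢ)

    tupleWeight-blockWeight : ∀ {k} (B : Fin k → Subset m) → (∀ i → ⊥ ∉ B i) → ∀ t →
                              tupleWeight (blockWeight u v B) t
                              ≡ 𝟙 (transversal? B t) * (u ^ zeros t * v ^ support t)
    tupleWeight-blockWeight B ⊥∉B t = by-cases (transversal? B t)
      where
      by-cases : (tr? : Dec (IsTransversalOf B t)) →
                 tupleWeight (blockWeight u v B) t ≡ 𝟙 tr? * (u ^ zeros t * v ^ support t)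
      by-cases (yes tr) = trans (tupleWeight-transversal B ⊥∉B t tr) (sym (ℤP.*-identityˡ _))
      by-cases (no ¬tr) = trans (tupleWeight-nonTransversal B t ¬tr)
                                (sym (ℤP.*-zeroˡ (u ^ zeros t * v ^ support t)))

    sumℤ-blockWeight : ∀ {k} (B : Fin k → Subset m) i →
                       sumℤ (map (blockWeight u v B i) (elements L)) ≡ u + v * + ∣ B i ∣
    sumℤ-blockWeight B i = begin
      sumℤ (map (blockWeight u v B i) (elements L))
        ≡⟨ sumℤ-map-+ (λ a → 𝟙 (a ≟F ⊥) * u) (λ a → 𝟙 (a ∈? B i) * v) (elements L) ⟩
      sumℤ (map (λ a → 𝟙 (a ≟F ⊥) * u) (elements L)) + sumℤ (map (λ a → 𝟙 (a ∈? B i) * v) (elements L))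
        ≡⟨ cong₂ _+_ (trans (sumℤ-map-cong (λ a → cong (_* u) (𝟙-cong sym sym (a ≟F ⊥) (⊥ ≟F a)))
                                           (elements L))
                            (sumℤ-δ ⊥ (λ _ → u)))
                     (sumℤ-map-*ʳ (λ a → 𝟙 (a ∈? B i)) v (elements L)) ⟩
      u + sumℤ (map (λ a → 𝟙 (a ∈? B i)) (elements L)) * v
        ≡⟨ cong (_+_ u) (trans (cong (_* v) (sumℤ-𝟙-∈ (B i))) (ℤP.*-comm (+ ∣ B i ∣) v)) ⟩
      u + v * + ∣ B i ∣ ∎
      where open ≡-Reasoning

    sumℤ-transversals : ∀ {k} (B : Fin k → Subset m) → (∀ i → ⊥ ∉ B i) →
                        sumℤ (map (λ t → 𝟙 (transversal? B t) * (u ^ zeros t * v ^ support t)) (allTuples L A k))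
                        ≡ prodℤ (map (λ i → u + v * + ∣ B i ∣) (allFin k))
    sumℤ-transversals {k} B ⊥∉B = begin
      sumℤ (map (λ t → 𝟙 (transversal? B t) * (u ^ zeros t * v ^ support t)) (allTuples L A k))
        ≡⟨ sumℤ-map-cong (sym ∘ tupleWeight-blockWeight B ⊥∉B) (allTuples L A k) ⟩
      sumℤ (map (tupleWeight (blockWeight u v B)) (allTuples L A k))
        ≡⟨ sumℤ-tupleWeight k (blockWeight u v B) ⟩
      prodℤ (map (λ i → sumℤ (map (blockWeight u v B i) (elements L))) (allFin k))
        ≡⟨ cong prodℤ (LP.map-cong (sumℤ-blockWeight B) (allFin k)) ⟩
      prodℤ (map (λ i → u + v * + ∣ B i ∣) (allFin k)) ∎
      where open ≡-Reasoning

  lookup≤join : ∀ {k} (t : Vec (Fin m) k) i → lookup t i ≤ join L A t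
  lookup≤join (a ∷ t) zero    = x≤x∨y a _
  lookup≤join (a ∷ t) (suc i) = ≤-trans (lookup≤join t i) (y≤x∨y a _)

  join-least : ∀ {k} (t : Vec (Fin m) k) {x} → (∀ i → lookup t i ≤ x) → join L A t ≤ x
  join-least []      _   = minimum _
  join-least (a ∷ t) t≤x = ∨-least (t≤x zero) (join-least t (t≤x ∘ suc))

module Theorem
    (L : FiniteLattice) (ρ : Fin (FiniteLattice.m L) → ℕ)
    (μ : Fin (FiniteLattice.m L) → ℤ) (μ-mobius : IsMobius L μ)
    (n : ℕ) (A : AtomPartition L n)
    (support≡rank : ∀ x t → IsTransversal L A t → join L A t ≡ x → suppSize L A t ≡ ρ x)
    (singleAtomBlock : ∀ x → x ≢ FiniteLattice.⊥ L →
                       ∃ λ i → ∣ AtomPartition.block A i ∩ atomsBelow L x ∣ ≡ 1)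
  where
  open FiniteLattice L
  open AtomPartition A
  open IsBoundedLattice isBoundedLattice using (minimum) renaming (trans to ≤-trans)
  open LatticeFacts L
  open Transversals L A

  rank-join : ∀ t → IsTransversal L A t → ρ (join L A t) ≡ support t
  rank-join t tr = trans (sym (support≡rank _ t tr refl)) (support≡suppSize t)

  ⊥∉block : ∀ i → ⊥ ∉ block i
  ⊥∉block i ⊥∈ = atom≢⊥ (onlyAtoms i ⊥ ⊥∈) refl

  blockBelow : Fin m → Fin n → Subset m
  blockBelow x i = block i ∩ atomsBelow L x

  transversal-below⁺ : ∀ {x t} → IsTransversal L A t × join L A t ≤ x → IsTransversalOf (blockBelow x) t
  transversal-below⁺ {x} {t} (tr , t≤x) i with tr i
  ... | inj₁ tᵢ≡⊥ = inj₁ tᵢ≡⊥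
  ... | inj₂ tᵢ∈  = inj₂ (x∈p∩q⁺ (tᵢ∈ , ∈-atomsBelow⁺ (onlyAtoms i _ tᵢ∈) (≤-trans (lookup≤join t i) t≤x)))

  transversal-below⁻ : ∀ {x t} → IsTransversalOf (blockBelow x) t → IsTransversal L A t × join L A t ≤ x
  transversal-below⁻ {x} {t} tr = (λ i → map₂ (proj₁ ∘ x∈p∩q⁻ _ _) (tr i)) , join-least t below
    where
    below : ∀ i → lookup t i ≤ x
    below i with tr i
    ... | inj₁ refl = minimum x
    ... | inj₂ tᵢ∈  = proj₂ (∈-atomsBelow⁻ (proj₂ (x∈p∩q⁻ (block i) _ tᵢ∈)))

  ⊥∉blockBelow : ∀ x i → ⊥ ∉ blockBelow x i
  ⊥∉blockBelow x i = ⊥∉block i ∘ proj₁ ∘ x∈p∩q⁻ (block i) (atomsBelow L x)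

  prodℤ-blockBelow : ∀ x → prodℤ (map (λ i → 1ℤ + -1ℤ * + ∣ blockBelow x i ∣) (allFin n)) ≡ δ⊥ L x
  prodℤ-blockBelow x with ⊥ ≟F x
  ... | yes refl = prodℤ-map-one _ (λ i → cong (λ c → 1ℤ + -1ℤ * + c) (atomsBelow-⊥-empty (block i)))
  ... | no ⊥≢x   = let i , single = singleAtomBlock x (⊥≢x ∘ sym) in
                   prodℤ-map-zero _ i (cong (λ c → 1ℤ + -1ℤ * + c) single)

  signedCount : Fin m → ℤ
  signedCount x = -1ℤ ^ ρ x * + numTransversals L A x

  signedCount-isMobius : IsMobius L signedCount
  signedCount-isMobius x = begin
    sumℤ (map signedCount (filter (_≤? x) (elements L)))
      ≡⟨ sumℤ-filter (_≤? x) signedCount (elements L) ⟩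
    sumℤ (map (λ y → 𝟙 (y ≤? x) * signedCount y) (elements L))
      ≡⟨ sumℤ-map-cong (λ y → sym (ℤP.*-assoc (𝟙 (y ≤? x)) _ _)) (elements L) ⟩
    sumℤ (map (λ y → 𝟙 (y ≤? x) * -1ℤ ^ ρ y * + numTransversals L A y) (elements L))
      ≡⟨ sumℤ-fibres (isTransversal? L A) (join L A) (λ y → 𝟙 (y ≤? x) * -1ℤ ^ ρ y) (allTuples L A n) ⟩
    sumℤ (map (λ t → 𝟙 (isTransversal? L A t) * (𝟙 (join L A t ≤? x) * -1ℤ ^ ρ (join L A t))) (allTuples L A n))
      ≡⟨ sumℤ-map-cong summand (allTuples L A n) ⟩
    sumℤ (map (λ t → 𝟙 (transversal? (blockBelow x) t) * (1ℤ ^ zeros t * -1ℤ ^ support t)) (allTuples L A n))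
      ≡⟨ sumℤ-transversals 1ℤ -1ℤ (blockBelow x) (⊥∉blockBelow x) ⟩
    prodℤ (map (λ i → 1ℤ + -1ℤ * + ∣ blockBelow x i ∣) (allFin n))
      ≡⟨ prodℤ-blockBelow x ⟩
    δ⊥ L x ∎
    where
    open ≡-Reasoning
    summand : ∀ t → 𝟙 (isTransversal? L A t) * (𝟙 (join L A t ≤? x) * -1ℤ ^ ρ (join L A t))
                    ≡ 𝟙 (transversal? (blockBelow x) t) * (1ℤ ^ zeros t * -1ℤ ^ support t)
    summand t = begin
      𝟙 tr? * (𝟙 (join L A t ≤? x) * -1ℤ ^ ρ (join L A t))
        ≡⟨ sym (ℤP.*-assoc (𝟙 tr?) _ _) ⟩
      𝟙 tr? * 𝟙 (join L A t ≤? x) * -1ℤ ^ ρ (join L A t)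
        ≡⟨ cong (_* -1ℤ ^ ρ (join L A t)) (sym (𝟙-×-dec tr? (join L A t ≤? x))) ⟩
      𝟙 (tr? ×-dec (join L A t ≤? x)) * -1ℤ ^ ρ (join L A t)
        ≡⟨ cong (_* -1ℤ ^ ρ (join L A t))
                (𝟙-cong (transversal-below⁺ {x} {t}) (transversal-below⁻ {x} {t}) (tr? ×-dec (join L A t ≤? x)) trB?) ⟩
      𝟙 trB? * -1ℤ ^ ρ (join L A t)
        ≡⟨ 𝟙-*-cong trB? (λ trB → cong (-1ℤ ^_) (rank-join t (proj₁ (transversal-below⁻ {x} {t} trB)))) ⟩
      𝟙 trB? * -1ℤ ^ support t
        ≡⟨ cong (𝟙 trB? *_) (sym (trans (cong (_* -1ℤ ^ support t) (ℤP.^-zeroˡ (zeros t))) (ℤP.*-identityˡ _))) ⟩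
      𝟙 trB? * (1ℤ ^ zeros t * -1ℤ ^ support t) ∎
      where
      tr? : Dec (IsTransversal L A t)
      tr? = isTransversal? L A t
      trB? : Dec (IsTransversalOf (blockBelow x) t)
      trB? = transversal? (blockBelow x) t

  μ≡signedCount : ∀ x → μ x ≡ signedCount x
  μ≡signedCount = mobius-unique μ-mobius signedCount-isMobius

  rank≤rankL : ∀ x → ρ x ℕ.≤ rankL L ρ
  rank≤rankL x = ≤-foldr-⊔ (∈-map⁺ ρ (∈-allFin x))

  -- Choosing one atom from every block gives a transversal of full support, hence of rank n.
  n≤rankL : n ℕ.≤ rankL L ρ
  n≤rankL = subst (ℕ._≤ rankL L ρ) rank-t₀≡n (rank≤rankL (join L A t₀))
    where
    t₀ : Vec (Fin m) n
    t₀ = Vec.tabulate (proj₁ ∘ nonempty)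
    t₀∈block : ∀ i → lookup t₀ i ∈ block i
    t₀∈block i = subst (_∈ block i) (sym (VP.lookup∘tabulate (proj₁ ∘ nonempty) i)) (proj₂ (nonempty i))
    rank-t₀≡n : ρ (join L A t₀) ≡ n
    rank-t₀≡n = trans (rank-join t₀ (inj₂ ∘ t₀∈block))
                      (count-all (λ a → ¬? (a ≟F ⊥)) t₀ (λ i → atom≢⊥ (onlyAtoms i _ (t₀∈block i))))

  corank-support : ∀ (t : Vec (Fin m) n) → rankL L ρ ∸ support t ≡ rankL L ρ ∸ n ℕ.+ zeros t
  corank-support t =
    trans (m∸n≡m∸[o+n]+o (zeros t) (subst (ℕ._≤ rankL L ρ) (sym (zeros+support t)) n≤rankL))
          (cong (λ k → rankL L ρ ∸ k ℕ.+ zeros t) (zeros+support t))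

  χ-factorisation : ∀ s → χ L ρ μ s
                        ≡ s ^ (rankL L ρ ∸ n) * prodℤ (map (λ i → s - + ∣ block i ∣) (allFin n))
  χ-factorisation s = begin
    sumℤ (map (λ x → μ x * s ^ (R ∸ ρ x)) (elements L))
      ≡⟨ sumℤ-map-cong (λ x → trans (cong (_* s ^ (R ∸ ρ x)) (μ≡signedCount x)) (swap (-1ℤ ^ ρ x) _ _))
                       (elements L) ⟩
    sumℤ (map (λ x → -1ℤ ^ ρ x * s ^ (R ∸ ρ x) * + numTransversals L A x) (elements L))
      ≡⟨ sumℤ-fibres (isTransversal? L A) (join L A) (λ x → -1ℤ ^ ρ x * s ^ (R ∸ ρ x)) (allTuples L A n) ⟩
    sumℤ (map (λ t → 𝟙 (isTransversal? L A t) * (-1ℤ ^ ρ (join L A t) * s ^ (R ∸ ρ (join L A t)))) (allTuples L A n))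
      ≡⟨ sumℤ-map-cong summand (allTuples L A n) ⟩
    sumℤ (map (λ t → s ^ (R ∸ n) * (𝟙 (isTransversal? L A t) * (s ^ zeros t * -1ℤ ^ support t))) (allTuples L A n))
      ≡⟨ sumℤ-map-*ˡ (s ^ (R ∸ n)) _ (allTuples L A n) ⟩
    s ^ (R ∸ n) * sumℤ (map (λ t → 𝟙 (isTransversal? L A t) * (s ^ zeros t * -1ℤ ^ support t)) (allTuples L A n))
      ≡⟨ cong (s ^ (R ∸ n) *_) (sumℤ-transversals s -1ℤ block ⊥∉block) ⟩
    s ^ (R ∸ n) * prodℤ (map (λ i → s + -1ℤ * + ∣ block i ∣) (allFin n))
      ≡⟨ cong (λ fs → s ^ (R ∸ n) * prodℤ fs)
              (LP.map-cong (λ i → cong (_+_ s) (ℤP.-1*i≡-i (+ ∣ block i ∣))) (allFin n)) ⟩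
    s ^ (R ∸ n) * prodℤ (map (λ i → s - + ∣ block i ∣) (allFin n)) ∎
    where
    open ≡-Reasoning
    R = rankL L ρ
    swap : ∀ a b c → a * b * c ≡ a * c * b
    swap = solve-∀
    rearrange : ∀ a b c d → a * (b * (c * d)) ≡ c * (a * (d * b))
    rearrange = solve-∀
    summand : ∀ t → 𝟙 (isTransversal? L A t) * (-1ℤ ^ ρ (join L A t) * s ^ (R ∸ ρ (join L A t)))
                    ≡ s ^ (R ∸ n) * (𝟙 (isTransversal? L A t) * (s ^ zeros t * -1ℤ ^ support t))
    summand t = begin
      𝟙 tr? * (-1ℤ ^ ρ (join L A t) * s ^ (R ∸ ρ (join L A t)))
        ≡⟨ 𝟙-*-cong tr? (λ tr → cong (λ r → -1ℤ ^ r * s ^ (R ∸ r)) (rank-join t tr)) ⟩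
      𝟙 tr? * (-1ℤ ^ support t * s ^ (R ∸ support t))
        ≡⟨ cong (λ e → 𝟙 tr? * (-1ℤ ^ support t * s ^ e)) (corank-support t) ⟩
      𝟙 tr? * (-1ℤ ^ support t * s ^ (R ∸ n ℕ.+ zeros t))
        ≡⟨ cong (λ p → 𝟙 tr? * (-1ℤ ^ support t * p)) (ℤP.^-distribˡ-+-* s (R ∸ n) (zeros t)) ⟩
      𝟙 tr? * (-1ℤ ^ support t * (s ^ (R ∸ n) * s ^ zeros t))
        ≡⟨ rearrange (𝟙 tr?) (-1ℤ ^ support t) (s ^ (R ∸ n)) (s ^ zeros t) ⟩
      s ^ (R ∸ n) * (𝟙 tr? * (s ^ zeros t * -1ℤ ^ support t)) ∎
      where
      tr? : Dec (IsTransversal L A t)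
      tr? = isTransversal? L A t

theorem4p2 : (L : FiniteLattice) → (ρ : Fin (FiniteLattice.m L) → ℕ) → IsRankFunction L ρ →
    (μ : Fin (FiniteLattice.m L) → ℤ) → IsMobius L μ →
    (n : ℕ) (A : AtomPartition L n) →
    (∀ (x : Fin (FiniteLattice.m L)) (t : Vec (Fin (FiniteLattice.m L)) n) →
       IsTransversal L A t → join L A t ≡ x → suppSize L A t ≡ ρ x) →
    (∀ (x : Fin (FiniteLattice.m L)) → x ≢ FiniteLattice.⊥ L →
       ∃ λ (i : Fin n) → ∣ AtomPartition.block A i ∩ atomsBelow L x ∣ ≡ 1) →
    (∀ (x : Fin (FiniteLattice.m L)) → μ x ≡ ((- + 1) ^ ρ x) * + numTransversals L A x)
    × (∀ (t : ℤ) → χ L ρ μ t ≡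
         (t ^ (rankL L ρ ∸ n)) * prodℤ (map (λ i → t - + ∣ AtomPartition.block A i ∣) (allFin n)))
theorem4p2 L ρ _ μ μ-mobius n A support≡rank singleAtomBlock =
  μ≡signedCount , χ-factorisation
  where open Theorem L ρ μ μ-mobius n A support≡rank singleAtomBlock
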